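{- Let $G$ be a connected graph of order $n\geq 2$ and let $H$ be a graph with $k\geq 1$ connected components $H_1,\ldots,H_k$. Then $$\max\{\chi_L(H_t+K_1): 1\leq t\leq k\}\leq \chi_L(G\odot H)\leq \chi_L(G)+\sum_{t=1}^{k}\bigl(\chi_L(H_t+K_1)-1\bigr).$$
   Context: All graphs are finite and simple. For a connected graph $G$, a $k$-coloring is a map $c:V(G)\to\{1,\ldots,k\}$ with $c(u)\neq c(v)$ whenever $uv\in E(G)$; it induces the partition $\Pi=\{C_1,\ldots,C_k\}$ into color classes. The color code of $v$ is $c_\Pi(v)=(d(v,C_1),\ldots,d(v,C_k))$, where $d(v,C_i)=\min\{d(v,x): x\in C_i\}$. The coloring is locating if distinct vertices have distinct color codes; $\chi_L(G)$ is the least $k$ admitting a locating $k$-coloring. The corona product $G\odot H$ (for $V(G)=\{a_1,\ldots,a_n\}$) is obtained from one copy of $G$ and $n$ copies of $H$ by joining $a_i$ to every vertex of the $i$-th copy of $H$. $H_t+K_1$ denotes the join of $H_t$ with a single new vertex adjacent to all vertices of $H_t$. -}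

module Defs where

open import Data.Nat using (ℕ; zero; suc; _≤_)
open import Data.Fin using (Fin)
open import Data.Maybe using (Maybe; just; nothing)
open import Data.Product using (Σ; ∃; _×_; _,_)
open import Data.Empty using (⊥)
open import Data.Unit using (⊤)
open import Relation.Nullary using (¬_)
open import Relation.Binary.PropositionalEquality using (_≡_; _≢_)

record Graph (V : Set) : Set₁ where
  field
    Adj   : V → V → Set
    sym   : ∀ {u v} → Adj u v → Adj v u
    irrefl : ∀ {v} → ¬ Adj v v
open Graph public

data Walk {V : Set} (G : Graph V) : V → V → ℕ → Set where
  here : ∀ {v} → Walk G v v zero
  step : ∀ {u w v n} → Adj G u w → Walk G w v n → Walk G u v (suc n)

Connected : {V : Set} → Graph V → Set
Connected {V} G = V × (∀ u v → ∃ λ n → Walk G u v n)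

-- k-coloring: proper map onto {1..k} (every colour class nonempty, so the
-- colour classes form a partition into k classes).
record Coloring {V : Set} (G : Graph V) (k : ℕ) : Set where
  field
    col    : V → Fin k
    proper : ∀ {u v} → Adj G u v → col u ≢ col v
    onto   : ∀ (i : Fin k) → ∃ λ v → col v ≡ i
open Coloring public

DistToClass : {V : Set} {G : Graph V} {k : ℕ} → Coloring G k → V → Fin k → ℕ → Set
DistToClass {V} {G} c v i d =
  (∃ λ x → (col c x ≡ i) × Walk G v x d) ×
  (∀ x m → col c x ≡ i → Walk G v x m → d ≤ m)

SameCode : {V : Set} {G : Graph V} {k : ℕ} → Coloring G k → V → V → Set
SameCode c u v = ∀ i d → (DistToClass c u i d → DistToClass c v i d)
                       × (DistToClass c v i d → DistToClass c u i d)

Locating : {V : Set} {G : Graph V} {k : ℕ} → Coloring G k → Set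
Locating {V} c = ∀ (u v : V) → SameCode c u v → u ≡ v

IsLocChromNum : {V : Set} → Graph V → ℕ → Set
IsLocChromNum G k =
  (Σ (Coloring G k) Locating) ×
  (∀ m → Σ (Coloring G m) Locating → k ≤ m)

-- Join H + K₁ : new vertex 'nothing' adjacent to all vertices of H.
JoinK1Adj : {V : Set} → Graph V → Maybe V → Maybe V → Set
JoinK1Adj H nothing  nothing  = ⊥
JoinK1Adj H nothing  (just _) = ⊤
JoinK1Adj H (just _) nothing  = ⊤
JoinK1Adj H (just u) (just v) = Adj H u v

joinK1 : {V : Set} → Graph V → Graph (Maybe V)
joinK1 H = record { Adj = JoinK1Adj H ; sym = λ {u} {v} → s {u} {v} ; irrefl = λ {v} → ir {v} }
  where
  s : ∀ {u v} → JoinK1Adj H u v → JoinK1Adj H v u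
  s {nothing} {nothing} ()
  s {nothing} {just _} p = p
  s {just _} {nothing} p = p
  s {just _} {just _} p = sym H p
  ir : ∀ {v} → ¬ JoinK1Adj H v v
  ir {nothing} ()
  ir {just v} p = irrefl H p

DUAdj : {k : ℕ} {W : Fin k → Set} → ((t : Fin k) → Graph (W t)) →
        Σ (Fin k) W → Σ (Fin k) W → Set
DUAdj {W = W} Hs (s , x) (t , y) = Σ (s ≡ t) λ { _≡_.refl → Adj (Hs s) x y }

disjUnion : {k : ℕ} {W : Fin k → Set} → ((t : Fin k) → Graph (W t)) → Graph (Σ (Fin k) W)
disjUnion {W = W} Hs = record { Adj = DUAdj Hs ; sym = λ {u} {v} → s {u} {v} ; irrefl = λ {v} → ir {v} }
  where
  s : ∀ {u v} → DUAdj Hs u v → DUAdj Hs v u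
  s (_≡_.refl , p) = _≡_.refl , sym (Hs _) p
  ir : ∀ {v} → ¬ DUAdj Hs v v
  ir (_≡_.refl , p) = irrefl (Hs _) p

-- Corona product G ⊙ H: vertex (a , nothing) is a_i of G,
-- vertex (a , just h) is vertex h in the copy of H attached to a.
CoronaAdj : {U W : Set} → Graph U → Graph W → U × Maybe W → U × Maybe W → Set
CoronaAdj G H (a , nothing) (b , nothing) = Adj G a b
CoronaAdj G H (a , nothing) (b , just _)  = a ≡ b
CoronaAdj G H (a , just _)  (b , nothing) = a ≡ b
CoronaAdj G H (a , just x)  (b , just y)  = (a ≡ b) × Adj H x y

corona : {U W : Set} → Graph U → Graph W → Graph (U × Maybe W)
corona G H = record { Adj = CoronaAdj G H ; sym = λ {u} {v} → s {u} {v} ; irrefl = λ {v} → ir {v} }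
  where
  s : ∀ {u v} → CoronaAdj G H u v → CoronaAdj G H v u
  s {_ , nothing} {_ , nothing} p = sym G p
  s {_ , nothing} {_ , just _} _≡_.refl = _≡_.refl
  s {_ , just _} {_ , nothing} _≡_.refl = _≡_.refl
  s {_ , just _} {_ , just _} (_≡_.refl , p) = _≡_.refl , sym H p
  ir : ∀ {v} → ¬ CoronaAdj G H v v
  ir {_ , nothing} p = irrefl G p
  ir {_ , just _} (_ , p) = irrefl H p

-- Lower bound: a vertex a of G together with the t-th component of its copy of H spans a copy of
-- H_t + K₁ in G ⊙ H which meets the rest of the graph only through a, and inside which any two
-- vertices are at distance at most two via a.  Hence two of its vertices whose codes agree in the
-- restricted colouring already have equal codes in G ⊙ H, so a locating colouring of G ⊙ H restricts
-- to a locating colouring of H_t + K₁ (after discarding the colours it misses).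
-- Upper bound: colour G by a locating colouring of G, and every copy of H_t by a locating colouring of
-- H_t + K₁ with the apex colour removed, in a fresh block of χ_L(H_t + K₁) − 1 colours for each t.
-- The distance from a pendant vertex to a colour class of G is one more than from its base vertex,
-- so the colours of G separate different copies, the blocks separate different components, and
-- inside one copy the code is the code in H_t + K₁.

module Submission where

open import Defs
open import Data.Nat using (ℕ; zero; suc; _≤_; _+_; _∸_; z≤n; s≤s)
open import Data.Nat.Properties using (≤-refl; ≤-trans; ≤-antisym; +-monoʳ-≤; +-cancelˡ-≤; m≤n⇒m≤1+n)
open import Data.Nat.ListAction using (sum)
open import Data.Fin using (Fin; zero; suc; _↑ˡ_; _↑ʳ_; splitAt; punchIn; punchOut)
open import Data.Fin.Properties using (↑ˡ-injective; ↑ʳ-injective; splitAt-↑ˡ; splitAt-↑ʳ; join-splitAt; punchIn-injective; punchInᵢ≢i; punchOut-injective; punchIn-punchOut; punchOut-cong; 0≢1+n; any?; all?; ¬∀⟶∃¬) renaming (_≟_ to _≟ᶠ_)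
open import Data.List using (tabulate)
open import Data.Maybe using (Maybe; just; nothing)
open import Data.Product using (Σ; ∃; _×_; _,_; proj₁; proj₂)
open import Data.Product.Properties using (,-injectiveˡ)
open import Data.Vec.Functional using (_∷_)
open import Data.Sum using (_⊎_; inj₁; inj₂)
open import Data.Empty using (⊥-elim)
open import Data.Unit using (tt)
open import Function using (_∘_)
open import Function.Bundles using (_⇔_; mk⇔; Equivalence)
open import Function.Construct.Composition using (_⇔-∘_)
open import Function.Construct.Symmetry using (⇔-sym)
open import Relation.Nullary using (¬_; Dec; yes; no)
open import Relation.Unary using (Pred; Decidable)
open import Relation.Binary.PropositionalEquality using (_≡_; _≢_; refl; trans; cong; subst) renaming (sym to ≡-sym)

open Equivalence using (to; from)

Least : (ℕ → Set) → ℕ → Set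
Least A d = A d × (∀ l → A l → d ≤ l)

ShiftedBy : ℕ → (ℕ → Set) → (ℕ → Set) → Set
ShiftedBy o A B = (∀ l → A l → ∃ λ e → e ≤ o + l × B e) ×
                  (∀ l → B l → ∃ λ e → o + e ≤ l × A e)

least-shift : ∀ {o A B} → ShiftedBy o A B → ∀ d → Least A d ⇔ Least B (o + d)
least-shift {o} {A} {B} (A→B , B→A) d = mk⇔ forth back
  where
  forth : Least A d → Least B (o + d)
  forth (a , a-min) with A→B d a
  ... | e , e≤ , b = subst B (≤-antisym e≤ (b-min e b)) b , b-min
    where
    b-min : ∀ l → B l → o + d ≤ l
    b-min l b with B→A l b
    ... | e , o+e≤l , a = ≤-trans (+-monoʳ-≤ o (a-min e a)) o+e≤l
  back : Least B (o + d) → Least A d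
  back (b , b-min) with B→A (o + d) b
  ... | e , o+e≤ , a = subst A (≤-antisym (+-cancelˡ-≤ o e d o+e≤) (a-min e a)) a , a-min
    where
    a-min : ∀ l → A l → d ≤ l
    a-min l a with A→B l a
    ... | e , e≤ , b = +-cancelˡ-≤ o d l (≤-trans (b-min e b) e≤)

least-transport : ∀ {o A A′ B B′} → ShiftedBy o A B → ShiftedBy o A′ B′ →
                  ∀ d → Least B (o + d) ⇔ Least B′ (o + d) → Least A d ⇔ Least A′ d
least-transport sh sh′ d B⇔B′ = ⇔-sym (least-shift sh′ d) ⇔-∘ (B⇔B′ ⇔-∘ least-shift sh d)

least-cong : ∀ {A B} → (∀ l → A l ⇔ B l) → ∀ d → Least A d ⇔ Least B d
least-cong A⇔B = least-shift ((λ l a → l , ≤-refl , to (A⇔B l) a) , (λ l b → l , ≤-refl , from (A⇔B l) b))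

module _ {V : Set} (G : Graph V) {K : Set} (c : V → K) where

  ClassWalk : V → K → ℕ → Set
  ClassWalk v i l = ∃ λ x → c x ≡ i × Walk G v x l

  ClassDist : V → K → ℕ → Set
  ClassDist v i = Least (ClassWalk v i)

  SameCodeBy : V → V → Set
  SameCodeBy u v = ∀ i d → ClassDist u i d ⇔ ClassDist v i d

  LocatingBy : Set
  LocatingBy = ∀ u v → SameCodeBy u v → u ≡ v

  ProperBy : Set
  ProperBy = ∀ {u v} → Adj G u v → c u ≢ c v

module _ {V : Set} {G : Graph V} {K : Set} {c : V → K} where

  sameCode-sym : ∀ {u v} → SameCodeBy G c u v → SameCodeBy G c v u
  sameCode-sym sc i d = ⇔-sym (sc i d)

  sameCode⇒sameColour : ∀ {u v} → SameCodeBy G c u v → c u ≡ c v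
  sameCode⇒sameColour {u} sc with to (sc (c u) 0) ((u , refl , here) , λ _ _ → z≤n)
  ... | (_ , cv≡cu , here) , _ = ≡-sym cv≡cu

module _ {V : Set} {G : Graph V} {k : ℕ} where

  distToClass⇔classDist : ∀ {c : Coloring G k} {v i d} → DistToClass c v i d ⇔ ClassDist G (col c) v i d
  distToClass⇔classDist = mk⇔ (λ (w , w-min) → w , λ l (x , cx , w′) → w-min x l cx w′)
                              (λ (w , w-min) → w , λ x l cx w′ → w-min l (x , cx , w′))

  locating⇒locatingBy : (c : Coloring G k) → Locating c → LocatingBy G (col c)
  locating⇒locatingBy c loc u v sc = loc u v λ i d →
    let e = ⇔-sym (distToClass⇔classDist {c}) ⇔-∘ (sc i d ⇔-∘ distToClass⇔classDist {c}) in to e , from e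

  locatingBy⇒locating : (c : Coloring G k) → LocatingBy G (col c) → Locating c
  locatingBy⇒locating c loc u v sc = loc u v λ i d →
    distToClass⇔classDist {c} ⇔-∘
    (mk⇔ (proj₁ (sc i d)) (proj₂ (sc i d)) ⇔-∘ ⇔-sym (distToClass⇔classDist {c}))

classWalk-cong : ∀ {V} {G : Graph V} {K₁ K₂ : Set} {c₁ : V → K₁} {c₂ : V → K₂} {i₁ i₂} →
                 (∀ x → c₁ x ≡ i₁ ⇔ c₂ x ≡ i₂) →
                 ∀ v l → ClassWalk G c₁ v i₁ l ⇔ ClassWalk G c₂ v i₂ l
classWalk-cong same v l = mk⇔ (λ (x , cx , w) → x , to (same x) cx , w)
                              (λ (x , cx , w) → x , from (same x) cx , w)

sameDist-recolour : ∀ {V} {G : Graph V} {K₁ K₂ : Set} {c₁ : V → K₁} {c₂ : V → K₂} {i₁ i₂} →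
  (∀ x → c₁ x ≡ i₁ ⇔ c₂ x ≡ i₂) → ∀ {u v} d →
  ClassDist G c₂ u i₂ d ⇔ ClassDist G c₂ v i₂ d → ClassDist G c₁ u i₁ d ⇔ ClassDist G c₁ v i₁ d
sameDist-recolour same {u} {v} d u⇔v =
  ⇔-sym (least-cong (classWalk-cong same v) d) ⇔-∘ (u⇔v ⇔-∘ least-cong (classWalk-cong same u) d)

module _ {V : Set} {K : Set} {N : ℕ} (c : V → K) {e : K → Fin N}
         (e-injective : ∀ {i j} → e i ≡ e j → i ≡ j) where

  ∘-proper : ∀ {G} → ProperBy G c → ProperBy G (e ∘ c)
  ∘-proper c-proper a eq = c-proper a (e-injective eq)

  ∘-locating : ∀ {G} → LocatingBy G c → LocatingBy G (e ∘ c)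
  ∘-locating c-loc u v sc = c-loc u v λ i d → sameDist-recolour (λ x → mk⇔ (cong e) e-injective) d (sc (e i) d)

Searchable : Set → Set₁
Searchable V = ∀ {P : Pred V _} → Decidable P → Dec (∃ P)

Maybe-searchable : ∀ {p} → Searchable (Maybe (Fin p))
Maybe-searchable P? with P? nothing | any? (P? ∘ just)
... | yes p | _          = yes (nothing , p)
... | no _  | yes (x , p) = yes (just x , p)
... | no ¬p | no ¬q       = no λ { (nothing , p) → ¬p p ; (just x , p) → ¬q (x , p) }

module _ {V : Set} {N : ℕ} (c : V → Fin (suc N)) {i : Fin (suc N)}
         (unused : ¬ ∃ λ v → c v ≡ i) where

  private
    i≢c : ∀ v → i ≢ c v
    i≢c v i≡cv = unused (v , ≡-sym i≡cv)

  withoutColour : V → Fin N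
  withoutColour v = punchOut (i≢c v)

  withoutColour-proper : ∀ {G} → ProperBy G c → ProperBy G withoutColour
  withoutColour-proper c-proper {u} {v} a eq = c-proper a (punchOut-injective (i≢c u) (i≢c v) eq)

  withoutColour-locating : ∀ {G} → LocatingBy G c → LocatingBy G withoutColour
  withoutColour-locating {G} c-loc u v sc = c-loc u v sc′
    where
    sc′ : SameCodeBy G c u v
    sc′ j d with i ≟ᶠ j
    ... | yes refl = least-cong (λ l → mk⇔ absurd absurd) d
      where
      absurd : ∀ {w w′ l} → ClassWalk G c w i l → ClassWalk G c w′ i l
      absurd (x , cx , _) = ⊥-elim (unused (x , cx))
    ... | no i≢j = sameDist-recolour same d (sc (punchOut i≢j) d)
      where
      same : ∀ x → c x ≡ j ⇔ withoutColour x ≡ punchOut i≢j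
      same x = mk⇔ (punchOut-cong i)
                   (λ eq → trans (≡-sym (punchIn-punchOut (i≢c x)))
                                 (trans (cong (punchIn i) eq) (punchIn-punchOut i≢j)))

locatingMap⇒locatingColoring : ∀ {V} {G : Graph V} → Searchable V →
  ∀ N (c : V → Fin N) → ProperBy G c → LocatingBy G c → ∃ λ r → r ≤ N × Σ (Coloring G r) Locating
locatingMap⇒locatingColoring search N c c-proper c-loc with all? (λ i → search (λ v → c v ≟ᶠ i))
... | yes onto = N , ≤-refl , coloring , locatingBy⇒locating coloring c-loc
  where
  coloring : Coloring _ N
  coloring = record { col = c ; proper = c-proper ; onto = onto }
locatingMap⇒locatingColoring search zero c c-proper c-loc | no ¬onto = ⊥-elim (¬onto λ ())
locatingMap⇒locatingColoring {G = G} search (suc N) c c-proper c-loc | no ¬onto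
  with ¬∀⟶∃¬ _ _ (λ i → search (λ v → c v ≟ᶠ i)) ¬onto
... | i , unused with locatingMap⇒locatingColoring search N (withoutColour c unused)
                        (withoutColour-proper c unused {G} c-proper) (withoutColour-locating c unused {G} c-loc)
...   | r , r≤N , coloring = r , m≤n⇒m≤1+n r≤N , coloring

record JoinEmbedding {W V : Set} (H : Graph W) (X : Graph V) : Set where
  field
    embed           : Maybe W → V
    embed-adj       : ∀ {u v} → Adj (joinK1 H) u v → Adj X (embed u) (embed v)
    embed-injective : ∀ {x y} → embed (just x) ≡ embed (just y) → x ≡ y
    neighbours      : ∀ {x w} → Adj X (embed (just x)) w →
                      w ≡ embed nothing ⊎ ∃ λ y → Adj H x y × w ≡ embed (just y)

module _ {W V : Set} {H : Graph W} {X : Graph V} (φ : JoinEmbedding H X) where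
  open JoinEmbedding φ

  embed-walk : ∀ {u v l} → Walk (joinK1 H) u v l → Walk X (embed u) (embed v) l
  embed-walk here = here
  embed-walk (step {u} {w} a rest) = step (embed-adj {u} {w} a) (embed-walk rest)

  apex-edge : ∀ x → Adj X (embed (just x)) (embed nothing)
  apex-edge x = embed-adj {just x} {nothing} tt

  escape : ∀ {x q l} → Walk X (embed (just x)) q l →
           (∃ λ e → suc e ≤ l × Walk X (embed nothing) q e) ⊎ (∃ λ y → q ≡ embed (just y))
  escape here = inj₂ (_ , refl)
  escape (step a rest) with neighbours a
  ... | inj₁ refl = inj₁ (_ , ≤-refl , rest)
  ... | inj₂ (_ , _ , refl) with escape rest
  ...   | inj₁ (e , e<l , rest′) = inj₁ (e , m≤n⇒m≤1+n e<l , rest′)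
  ...   | inj₂ y = inj₂ y

  module _ {N : ℕ} {c : V → Fin N} where

    -- Every vertex of the copy is reached from embed (just v) within two steps through the apex, so
    -- only walks of length at most one can tell u from v, and those are seen by the codes in H + K₁.
    sameCode⇒shorterClassWalk : ∀ {u v} → SameCodeBy (joinK1 H) (c ∘ embed) (just u) (just v) →
                   ∀ i l → ClassWalk X c (embed (just u)) i l →
                   ∃ λ e → e ≤ l × ClassWalk X c (embed (just v)) i e
    sameCode⇒shorterClassWalk {v = v} sc i _ (_ , cq , here) =
      0 , z≤n , embed (just v) , trans (≡-sym (sameCode⇒sameColour sc)) cq , here
    sameCode⇒shorterClassWalk {u} {v} sc i _ (q , cq , step a here) with neighbours a
    ... | inj₁ refl = 1 , ≤-refl , q , cq , step (apex-edge v) here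
    ... | inj₂ (y , u~y , refl) with c (embed (just u)) ≟ᶠ i
    ...   | yes cu≡i = 0 , z≤n , embed (just v) , trans (≡-sym (sameCode⇒sameColour sc)) cu≡i , here
    ...   | no cu≢i with to (sc i 1) ((just y , cq , step u~y here) , one-is-least)
      where
      one-is-least : ∀ l → ClassWalk (joinK1 H) (c ∘ embed) (just u) i l → 1 ≤ l
      one-is-least _ (_ , cx , here)   = ⊥-elim (cu≢i cx)
      one-is-least _ (_ , _ , step _ _) = s≤s z≤n
    ...     | (x′ , cx′ , w′) , _ = 1 , ≤-refl , embed x′ , cx′ , embed-walk w′
    sameCode⇒shorterClassWalk {v = v} sc i _ (q , cq , w@(step _ (step _ _))) with escape w
    ... | inj₁ (e , e<l , w′) = suc e , e<l , q , cq , step (apex-edge v) w′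
    ... | inj₂ (y , refl) =
      2 , s≤s (s≤s z≤n) , q , cq , step (apex-edge v) (step (embed-adj {nothing} {just y} tt) here)

    restrict-proper : ProperBy X c → ProperBy (joinK1 H) (c ∘ embed)
    restrict-proper c-proper {u} {v} a = c-proper (embed-adj {u} {v} a)

    restrict-locating : ProperBy X c → LocatingBy X c → LocatingBy (joinK1 H) (c ∘ embed)
    restrict-locating _ _ nothing nothing _ = refl
    restrict-locating c-proper _ nothing (just y) sc =
      ⊥-elim (c-proper (embed-adj {nothing} {just y} tt) (sameCode⇒sameColour sc))
    restrict-locating c-proper _ (just x) nothing sc =
      ⊥-elim (c-proper (apex-edge x) (sameCode⇒sameColour sc))
    restrict-locating _ c-loc (just x) (just y) sc = cong just (embed-injective (c-loc _ _ λ i →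
      least-shift (sameCode⇒shorterClassWalk sc i , sameCode⇒shorterClassWalk (sameCode-sym sc) i)))

χL-joinK1-≤ : ∀ {p V} {H : Graph (Fin p)} {X : Graph V} → JoinEmbedding H X →
              ∀ {χ N} → IsLocChromNum (joinK1 H) χ → Σ (Coloring X N) Locating → χ ≤ N
χL-joinK1-≤ φ {N = N} (_ , minimal) (c , c-loc)
  with locatingMap⇒locatingColoring Maybe-searchable N (col c ∘ JoinEmbedding.embed φ)
         (restrict-proper φ (proper c)) (restrict-locating φ (proper c) (locating⇒locatingBy c c-loc))
... | r , r≤N , coloring = ≤-trans (minimal r coloring) r≤N

module _ {U : Set} (G : Graph U) {k : ℕ} {W : Fin k → Set} (Hs : (t : Fin k) → Graph (W t)) where

  componentCopy : U → (t : Fin k) → JoinEmbedding (Hs t) (corona G (disjUnion Hs))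
  componentCopy a t = record
    { embed           = embed
    ; embed-adj       = λ {u} {v} → adj {u} {v}
    ; embed-injective = λ { refl → refl }
    ; neighbours      = nbrs
    }
    where
    embed : Maybe (W t) → U × Maybe (Σ (Fin k) W)
    embed nothing  = a , nothing
    embed (just x) = a , just (t , x)
    adj : ∀ {u v} → Adj (joinK1 (Hs t)) u v → Adj (corona G (disjUnion Hs)) (embed u) (embed v)
    adj {nothing} {just _}  _   = refl
    adj {just _}  {nothing} _   = refl
    adj {just _}  {just _}  x~y = refl , refl , x~y
    nbrs : ∀ {x w} → Adj (corona G (disjUnion Hs)) (embed (just x)) w →
           w ≡ embed nothing ⊎ ∃ λ y → Adj (Hs t) x y × w ≡ embed (just y)
    nbrs {w = _ , nothing}      refl              = inj₁ refl
    nbrs {w = _ , just (_ , y)} (refl , refl , x~y) = inj₂ (y , x~y , refl)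

module _ {U W : Set} {G : Graph U} {H : Graph W} where

  pendant-edge : ∀ {b b′ h o} → Adj (corona G H) (b , just h) (b′ , o) → b ≡ b′
  pendant-edge {o = nothing} b≡b′       = b≡b′
  pendant-edge {o = just _}  (b≡b′ , _) = b≡b′

  corona-edge : ∀ {b b′ o o′} → Adj (corona G H) (b , o) (b′ , o′) → Adj G b b′ ⊎ b ≡ b′
  corona-edge {o = nothing} {nothing} b~b′ = inj₁ b~b′
  corona-edge {o = nothing} {just _}  b≡b′ = inj₂ b≡b′
  corona-edge {o = just h} {o′}      a    = inj₂ (pendant-edge {h = h} {o′} a)

  lift-walk : ∀ {b b′ l} → Walk G b b′ l → Walk (corona G H) (b , nothing) (b′ , nothing) l
  lift-walk here          = here
  lift-walk (step a rest) = step a (lift-walk rest)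

  project-walk : ∀ {b b′ o o′ l} → Walk (corona G H) (b , o) (b′ , o′) l →
                 ∃ λ e → e ≤ l × Walk G b b′ e
  project-walk here = 0 , z≤n , here
  project-walk {b} {o = o} (step {w = c , o′} a rest) with corona-edge {b} {c} {o} {o′} a | project-walk rest
  ... | inj₁ b~c  | e , e≤l , w = suc e , s≤s e≤l , step b~c w
  ... | inj₂ refl | e , e≤l , w = e , m≤n⇒m≤1+n e≤l , w

  project-pendantWalk : ∀ {b b′ h l} → Walk (corona G H) (b , just h) (b′ , nothing) l →
                        ∃ λ e → suc e ≤ l × Walk G b b′ e
  project-pendantWalk {b} {h = h} (step {w = c , o} a rest) with pendant-edge {b} {c} {h} {o} a | project-walk rest
  ... | refl | e , e≤l , w = e , s≤s e≤l , w

↑ˡ≢↑ʳ : ∀ {m n} (i : Fin m) (j : Fin n) → i ↑ˡ n ≢ m ↑ʳ j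
↑ˡ≢↑ʳ {m} {n} i j eq with trans (≡-sym (splitAt-↑ˡ m i n)) (trans (cong (splitAt m) eq) (splitAt-↑ʳ m n j))
... | ()

injectBlock : ∀ {k} (f : Fin k → ℕ) → Σ (Fin k) (Fin ∘ f) → Fin (sum (tabulate f))
injectBlock f (zero  , y) = y ↑ˡ _
injectBlock f (suc t , y) = f zero ↑ʳ injectBlock (f ∘ suc) (t , y)

injectBlock-injective : ∀ {k} (f : Fin k → ℕ) {p q} → injectBlock f p ≡ injectBlock f q → p ≡ q
injectBlock-injective f {zero  , _} {zero  , _} eq = cong (zero ,_) (↑ˡ-injective _ _ _ eq)
injectBlock-injective f {zero  , _} {suc _ , _} eq = ⊥-elim (↑ˡ≢↑ʳ _ _ eq)
injectBlock-injective f {suc _ , _} {zero  , _} eq = ⊥-elim (↑ˡ≢↑ʳ _ _ (≡-sym eq))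
injectBlock-injective f {suc t , y} {suc t′ , y′} eq
  with injectBlock-injective (f ∘ suc) {t , y} {t′ , y′} (↑ʳ-injective (f zero) _ _ eq)
... | refl = refl

injectBlock-surjective : ∀ {k} (f : Fin k → ℕ) s → ∃ λ p → injectBlock f p ≡ s
injectBlock-surjective {suc _} f s with splitAt (f zero) s | join-splitAt (f zero) (sum (tabulate (f ∘ suc))) s
... | inj₁ y  | eq = (zero , y) , eq
... | inj₂ s′ | eq with injectBlock-surjective (f ∘ suc) s′
...   | (t , y) , refl = (suc t , y) , eq

punchOut∸ : ∀ {χ} {i j : Fin χ} → i ≢ j → Fin (χ ∸ 1)
punchOut∸ {suc _} = punchOut

punchIn∸ : ∀ {χ} → Fin χ → Fin (χ ∸ 1) → Fin χ
punchIn∸ {suc _} = punchIn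

punchIn∸-punchOut∸ : ∀ {χ} {i j : Fin χ} (i≢j : i ≢ j) → punchIn∸ i (punchOut∸ i≢j) ≡ j
punchIn∸-punchOut∸ {suc _} = punchIn-punchOut

punchIn∸-injective : ∀ {χ} (i : Fin χ) {y y′} → punchIn∸ i y ≡ punchIn∸ i y′ → y ≡ y′
punchIn∸-injective {suc _} i = punchIn-injective i _ _

punchIn∸ᵢ≢i : ∀ {χ} (i : Fin χ) y → punchIn∸ i y ≢ i
punchIn∸ᵢ≢i {suc _} = punchInᵢ≢i

module CoronaColouring {U : Set} {G : Graph U} (a₀ : U) {k : ℕ} {W : Fin k → Set}
  {Hs : (t : Fin k) → Graph (W t)} {χG : ℕ} {χH : Fin k → ℕ}
  (G-locating : Σ (Coloring G χG) Locating)
  (J-locating : ∀ t → Σ (Coloring (joinK1 (Hs t)) (χH t)) Locating) where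

  C : Graph (U × Maybe (Σ (Fin k) W))
  C = corona G (disjUnion Hs)

  J : (t : Fin k) → Graph (Maybe (W t))
  J t = joinK1 (Hs t)

  cG : Coloring G χG
  cG = proj₁ G-locating

  cJ : ∀ t → Coloring (J t) (χH t)
  cJ t = proj₁ (J-locating t)

  blockSize : Fin (suc k) → ℕ
  blockSize = χG ∷ λ t → χH t ∸ 1

  apexColour : ∀ t → Fin (χH t)
  apexColour t = col (cJ t) nothing

  apex≢ : ∀ t x → apexColour t ≢ col (cJ t) (just x)
  apex≢ t x eq = proper (cJ t) {just x} {nothing} tt (≡-sym eq)

  -- Block zero holds the colours of G, block suc t the colours of H_t + K₁ other than the apex colour.
  Colour : Set
  Colour = Σ (Fin (suc k)) (Fin ∘ blockSize)

  pendantColour : ∀ t → W t → Fin (χH t ∸ 1)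
  pendantColour t x = punchOut∸ (apex≢ t x)

  colour : U × Maybe (Σ (Fin k) W) → Colour
  colour (b , nothing)      = zero , col cG b
  colour (_ , just (t , x)) = suc t , pendantColour t x

  base-hasColour : ∀ {b i} → colour (b , nothing) ≡ (zero , i) ⇔ col cG b ≡ i
  base-hasColour = mk⇔ (λ { refl → refl }) (cong (zero ,_))

  pendant-hasColour : ∀ {t x y} →
    _≡_ {A = Colour} (suc t , pendantColour t x) (suc t , y) ⇔ col (cJ t) (just x) ≡ punchIn∸ (apexColour t) y
  pendant-hasColour {t = t} {x} = mk⇔
    (λ { refl → ≡-sym (punchIn∸-punchOut∸ (apex≢ t x)) })
    (λ eq → cong (suc t ,_)
               (punchIn∸-injective (apexColour t) (trans (punchIn∸-punchOut∸ (apex≢ t x)) eq)))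

  pendantOfColour : ∀ t y → ∃ λ x → col (cJ t) (just x) ≡ punchIn∸ (apexColour t) y
  pendantOfColour t y with onto (cJ t) (punchIn∸ (apexColour t) y)
  ... | nothing , e = ⊥-elim (punchIn∸ᵢ≢i _ _ (≡-sym e))
  ... | just x  , e = x , e

  colour-proper : ProperBy C colour
  colour-proper {_ , nothing} {_ , nothing} b~b′ eq = proper cG b~b′ (to base-hasColour eq)
  colour-proper {_ , nothing} {_ , just _}  _    ()
  colour-proper {_ , just _}  {_ , nothing} _    ()
  colour-proper {_ , just (t , x)} {_ , just (_ , x′)} (refl , refl , x~x′) eq =
    proper (cJ t) {just x} {just x′} x~x′
      (trans (to pendant-hasColour eq) (punchIn∸-punchOut∸ (apex≢ t x′)))

  colour-covers : ∀ κ → ∃ λ v → colour v ≡ κ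
  colour-covers (zero , i) with onto cG i
  ... | b , refl = (b , nothing) , refl
  colour-covers (suc t , y) with pendantOfColour t y
  ... | x , e = (a₀ , just (t , x)) , from pendant-hasColour e

  base-shift : ∀ b i → ShiftedBy 0 (ClassWalk G (col cG) b i) (ClassWalk C colour (b , nothing) (zero , i))
  base-shift b i =
    (λ l (x , cx , w) → l , ≤-refl , (x , nothing) , from base-hasColour cx , lift-walk w) , back
    where
    back : ∀ l → ClassWalk C colour (b , nothing) (zero , i) l →
           ∃ λ e → e ≤ l × ClassWalk G (col cG) b i e
    back l ((x , nothing) , cx , w) with project-walk w
    ... | e , e≤l , w′ = e , e≤l , x , to base-hasColour cx , w′
    back l ((_ , just _) , () , _)

  pendantBase-shift : ∀ b h i →
    ShiftedBy 1 (ClassWalk G (col cG) b i) (ClassWalk C colour (b , just h) (zero , i))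
  pendantBase-shift b h i =
    (λ l (x , cx , w) → suc l , ≤-refl , (x , nothing) , from base-hasColour cx , step refl (lift-walk w)) , back
    where
    back : ∀ l → ClassWalk C colour (b , just h) (zero , i) l →
           ∃ λ e → 1 + e ≤ l × ClassWalk G (col cG) b i e
    back l ((x , nothing) , cx , w) with project-pendantWalk w
    ... | e , e<l , w′ = e , e<l , x , to base-hasColour cx , w′
    back l ((_ , just _) , () , _)

  pendantBlock-shift : ∀ b t x y →
    ShiftedBy 0 (ClassWalk (J t) (col (cJ t)) (just x) (punchIn∸ (apexColour t) y))
                (ClassWalk C colour (b , just (t , x)) (suc t , y))
  pendantBlock-shift b t x y = forth , back
    where
    copy : JoinEmbedding (Hs t) C
    copy = componentCopy G Hs b t
    forth : ∀ l → ClassWalk (J t) (col (cJ t)) (just x) (punchIn∸ (apexColour t) y) l →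
            ∃ λ e → e ≤ l × ClassWalk C colour (b , just (t , x)) (suc t , y) e
    forth l (nothing , cx , _) = ⊥-elim (punchIn∸ᵢ≢i _ _ (≡-sym cx))
    forth l (just x″ , cx , w) = l , ≤-refl , (b , just (t , x″)) , from pendant-hasColour cx , embed-walk copy w
    back : ∀ l → ClassWalk C colour (b , just (t , x)) (suc t , y) l →
           ∃ λ e → e ≤ l × ClassWalk (J t) (col (cJ t)) (just x) (punchIn∸ (apexColour t) y) e
    back _ (_ , cq , here) = 0 , z≤n , just x , to pendant-hasColour cq , here
    back _ (q , cq , step a here) with JoinEmbedding.neighbours copy {x} {q} a
    ... | inj₁ refl = ⊥-elim (0≢1+n (,-injectiveˡ cq))
    ... | inj₂ (x′ , x~x′ , refl) = 1 , ≤-refl , just x′ , to pendant-hasColour cq , step x~x′ here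
    back _ (_ , _ , step _ (step _ _)) with pendantOfColour t y
    ... | x₀ , cx₀ = 2 , s≤s (s≤s z≤n) , just x₀ , cx₀ , step {w = nothing} tt (step tt here)

  apexClass-shorterWalk : ∀ t x x′ l → ClassWalk (J t) (col (cJ t)) (just x) (apexColour t) l →
                          ∃ λ e → e ≤ l × ClassWalk (J t) (col (cJ t)) (just x′) (apexColour t) e
  apexClass-shorterWalk t x _ _ (_ , cx , here)   = ⊥-elim (apex≢ t x (≡-sym cx))
  apexClass-shorterWalk t _ _ _ (_ , _ , step _ _) = 1 , s≤s z≤n , nothing , refl , step tt here

  sameCode-base : ∀ {b b′} → SameCodeBy C colour (b , nothing) (b′ , nothing) →
                  SameCodeBy G (col cG) b b′
  sameCode-base {b} {b′} sc i d = least-transport (base-shift b i) (base-shift b′ i) d (sc (zero , i) d)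

  sameCode-pendant-base : ∀ {b b′ h h′} → SameCodeBy C colour (b , just h) (b′ , just h′) →
                          SameCodeBy G (col cG) b b′
  sameCode-pendant-base {b} {b′} {h} {h′} sc i d =
    least-transport (pendantBase-shift b h i) (pendantBase-shift b′ h′ i) d (sc (zero , i) (1 + d))

  sameCode-pendant : ∀ {b t x x′} → SameCodeBy C colour (b , just (t , x)) (b , just (t , x′)) →
                     SameCodeBy (J t) (col (cJ t)) (just x) (just x′)
  sameCode-pendant {b} {t} {x} {x′} sc j d with apexColour t ≟ᶠ j
  ... | yes refl = least-shift (apexClass-shorterWalk t x x′ , apexClass-shorterWalk t x′ x) d
  ... | no apex≢j rewrite ≡-sym (punchIn∸-punchOut∸ apex≢j) =
    least-transport (pendantBlock-shift b t x y) (pendantBlock-shift b t x′ y) d (sc (suc t , y) d)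
    where
    y : Fin (χH t ∸ 1)
    y = punchOut∸ apex≢j

  colour-locating : LocatingBy C colour
  colour-locating (b , nothing) (b′ , nothing) sc =
    cong (_, nothing) (locating⇒locatingBy cG (proj₂ G-locating) b b′ (sameCode-base sc))
  colour-locating (_ , nothing) (_ , just _) sc with sameCode⇒sameColour sc
  ... | ()
  colour-locating (_ , just _) (_ , nothing) sc with sameCode⇒sameColour sc
  ... | ()
  colour-locating (b , just (t , x)) (b′ , just (_ , x′)) sc with ,-injectiveˡ (sameCode⇒sameColour sc)
  ... | refl with locating⇒locatingBy cG (proj₂ G-locating) b b′ (sameCode-pendant-base sc)
  ...   | refl with locating⇒locatingBy (cJ t) (proj₂ (J-locating t)) (just x) (just x′) (sameCode-pendant sc)
  ...     | refl = refl

  coloring : Coloring C (sum (tabulate blockSize))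
  coloring = record
    { col    = injectBlock blockSize ∘ colour
    ; proper = λ {u} {v} → ∘-proper colour (injectBlock-injective blockSize) {C} colour-proper {u} {v}
    ; onto   = covers
    }
    where
    covers : ∀ j → ∃ λ v → injectBlock blockSize (colour v) ≡ j
    covers j with injectBlock-surjective blockSize j
    ... | κ , refl with colour-covers κ
    ...   | v , refl = v , refl

  locatingColoring : Σ (Coloring C (χG + sum (tabulate (λ t → χH t ∸ 1)))) Locating
  locatingColoring =
    coloring , locatingBy⇒locating coloring (∘-locating colour (injectBlock-injective blockSize) colour-locating)

χL-corona-≤ : ∀ {U} {G : Graph U} {k} {W : Fin k → Set} {Hs : (t : Fin k) → Graph (W t)}
              {χG : ℕ} {χH : Fin k → ℕ} {χC : ℕ} → U →
              IsLocChromNum G χG → (∀ t → IsLocChromNum (joinK1 (Hs t)) (χH t)) →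
              IsLocChromNum (corona G (disjUnion Hs)) χC → χC ≤ χG + sum (tabulate (λ t → χH t ∸ 1))
χL-corona-≤ a (G-locating , _) J-χL (_ , minimal) =
  minimal _ (CoronaColouring.locatingColoring a G-locating (proj₁ ∘ J-χL))

theorem1 : (n : ℕ) → 2 ≤ n → (G : Graph (Fin n)) → Connected G →
           (k : ℕ) → 1 ≤ k → (m : Fin k → ℕ) →
           (Hs : (t : Fin k) → Graph (Fin (m t))) → (∀ t → Connected (Hs t)) →
           (χG : ℕ) → IsLocChromNum G χG →
           (χH : Fin k → ℕ) → (∀ t → IsLocChromNum (joinK1 (Hs t)) (χH t)) →
           (χC : ℕ) → IsLocChromNum (corona G (disjUnion Hs)) χC →
           (∀ t → χH t ≤ χC) ×
           (χC ≤ χG + sum (tabulate (λ t → χH t ∸ 1)))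
theorem1 n _ G (a , _) k _ m Hs _ χG G-χL χH J-χL χC C-χL =
  (λ t → χL-joinK1-≤ (componentCopy G Hs a t) (J-χL t) (proj₁ C-χL)) ,
  χL-corona-≤ a G-χL J-χL C-χL
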